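{- Let $\mathbb{A}$ be a slanted $\mathcal{L}_{\mathrm{LE}}$-algebra. For all $f\in\mathcal{F}$, $g\in\mathcal{G}$, all $\overline{k}\in K(A^\delta)^{\epsilon_f}$ and all $\overline{o}\in O(A^\delta)^{\epsilon_g}$: (1) $g^\pi(\overline{o})\in O(A^\delta)$; (2) $f^\sigma(\overline{k})\in K(A^\delta)$.
   Context: An LE-signature: disjoint sets $\mathcal{F},\mathcal{G}$ of connectives, each $h$ with arity $n_h$ and order-type $\epsilon_h\in\{1,\partial\}^{n_h}$. For a bounded lattice $A$, $A^\delta$ is its canonical extension (complete lattice containing $A$ as a dense and compact sublattice); $K(A^\delta)$ = meets of subsets of $A$ (closed elements), $O(A^\delta)$ = joins of subsets of $A$ (open elements). For an order-type $\epsilon$, $K(A^\delta)^\epsilon$ denotes the product with factor $K(A^\delta)$ in coordinates with $\epsilon(i)=1$ and $O(A^\delta)$ in coordinates with $\epsilon(i)=\partial$; $O(A^\delta)^\epsilon$ has $O(A^\delta)$ where $\epsilon(i)=1$ and $K(A^\delta)$ where $\epsilon(i)=\partial$. $A^\epsilon=\prod_iA^{\epsilon(i)}$ ($A^1=A$, $A^\partial$ dual) with order $\leq^\epsilon$. A slanted $\mathcal{L}_{\mathrm{LE}}$-algebra: $A$ with, for $f\in\mathcal{F}$, $f:A^{\epsilon_f}\to A^\delta$ preserving finite (incl. empty) joins of $A^{\epsilon_f}$ coordinatewise with values in $K(A^\delta)$, and for $g\in\mathcal{G}$, $g:A^{\epsilon_g}\to A^\delta$ preserving finite (incl. empty) meets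 of $A^{\epsilon_g}$ coordinatewise with values in $O(A^\delta)$. $f^\sigma(\overline{k})=\bigwedge\{f(\overline{a})\mid\overline{a}\in A^{\epsilon_f},\overline{k}\leq^{\epsilon_f}\overline{a}\}$ for $\overline{k}\in K(A^\delta)^{\epsilon_f}$ (extended to arbitrary tuples as the join over closed tuples below); $g^\pi(\overline{o})=\bigvee\{g(\overline{a})\mid\overline{a}\in A^{\epsilon_g},\overline{a}\leq^{\epsilon_g}\overline{o}\}$ for $\overline{o}\in O(A^\delta)^{\epsilon_g}$ (extended as the meet over open tuples above). -}

module Defs where

open import Level using (0ℓ)
open import Data.Nat using (ℕ)
open import Data.Fin using (Fin)
open import Data.Bool using (Bool; true; false; if_then_else_)
open import Data.Empty using (⊥)
open import Data.List using (List; foldr)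
open import Data.List.Relation.Unary.All using (All)
open import Data.Product using (Σ; Σ-syntax; _×_; proj₁)
open import Data.Vec.Functional using (Vector; updateAt)
open import Function using (_∘_; const)
open import Relation.Binary using (Rel; IsPartialOrder)
open import Relation.Binary.Lattice.Bundles using (BoundedLattice)

-- Order types: each coordinate is 1 (monotone) or ∂ (antitone)

data Polarity : Set where
  one : Polarity
  ∂   : Polarity

-- LE-signatures: two (disjoint, being separate types) sets of connectives,
-- each with an arity and an order-type.

record LESignature : Set₁ where
  field
    𝓕   : Set
    𝓖   : Set
    arF : 𝓕 → ℕ
    εF  : (f : 𝓕) → Fin (arF f) → Polarity
    arG : 𝓖 → ℕ
    εG  : (g : 𝓖) → Fin (arG g) → Polarity

record CompleteLattice : Set₁ where
  infix 4 _≈_ _≤_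
  field
    Carrier        : Set
    _≈_            : Rel Carrier 0ℓ
    _≤_            : Rel Carrier 0ℓ
    isPartialOrder : IsPartialOrder _≈_ _≤_
    ⋁              : {I : Set} → (I → Carrier) → Carrier
    ⋀              : {I : Set} → (I → Carrier) → Carrier
    ⋁-upper        : {I : Set} (x : I → Carrier) (i : I) → x i ≤ ⋁ x
    ⋁-least        : {I : Set} (x : I → Carrier) (z : Carrier) →
                     ((i : I) → x i ≤ z) → ⋁ x ≤ z
    ⋀-lower        : {I : Set} (x : I → Carrier) (i : I) → ⋀ x ≤ x i
    ⋀-greatest     : {I : Set} (x : I → Carrier) (z : Carrier) →
                     ((i : I) → z ≤ x i) → z ≤ ⋀ x

  _⊔_ : Carrier → Carrier → Carrier
  x ⊔ y = ⋁ {Bool} (λ b → if b then x else y)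

  _⊓_ : Carrier → Carrier → Carrier
  x ⊓ y = ⋀ {Bool} (λ b → if b then x else y)

  bot : Carrier
  bot = ⋁ {⊥} (λ ())

  top : Carrier
  top = ⋀ {⊥} (λ ())

module _ (A : BoundedLattice 0ℓ 0ℓ 0ℓ) (C : CompleteLattice) where
  private
    module A = BoundedLattice A
    module C = CompleteLattice C

  IsClosed : (A.Carrier → C.Carrier) → C.Carrier → Set₁
  IsClosed e x = Σ[ S ∈ (A.Carrier → Set) ] x C.≈ C.⋀ {Σ A.Carrier S} (e ∘ proj₁)

  IsOpen : (A.Carrier → C.Carrier) → C.Carrier → Set₁
  IsOpen e x = Σ[ S ∈ (A.Carrier → Set) ] x C.≈ C.⋁ {Σ A.Carrier S} (e ∘ proj₁)

record CanonicalExtension (A : BoundedLattice 0ℓ 0ℓ 0ℓ) : Set₁ where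
  private module A = BoundedLattice A
  field
    C : CompleteLattice
  open CompleteLattice C
  field
    e        : A.Carrier → Carrier
    e-mono   : ∀ {a b} → a A.≤ b → e a ≤ e b
    e-refl   : ∀ {a b} → e a ≤ e b → a A.≤ b
    e-∨      : ∀ a b → e (a A.∨ b) ≈ e a ⊔ e b
    e-∧      : ∀ a b → e (a A.∧ b) ≈ e a ⊓ e b
    e-⊤      : e A.⊤ ≈ top
    e-⊥      : e A.⊥ ≈ bot
    dense-K  : ∀ x → Σ[ I ∈ Set ] Σ[ k ∈ (I → Carrier) ]
                 ((∀ i → IsClosed A C e (k i)) × x ≈ ⋁ k)
    dense-O  : ∀ x → Σ[ I ∈ Set ] Σ[ o ∈ (I → Carrier) ]
                 ((∀ i → IsOpen A C e (o i)) × x ≈ ⋀ o)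
    compact  : (S T : A.Carrier → Set) →
               ⋀ {Σ A.Carrier S} (e ∘ proj₁) ≤ ⋁ {Σ A.Carrier T} (e ∘ proj₁) →
               Σ[ xs ∈ List A.Carrier ] Σ[ ys ∈ List A.Carrier ]
                 (All S xs × All T ys ×
                  foldr A._∧_ A.⊤ xs A.≤ foldr A._∨_ A.⊥ ys)

module _ (A : BoundedLattice 0ℓ 0ℓ 0ℓ) where
  private module A = BoundedLattice A

  joinε : Polarity → A.Carrier → A.Carrier → A.Carrier
  joinε one = A._∨_
  joinε ∂   = A._∧_

  botε : Polarity → A.Carrier
  botε one = A.⊥
  botε ∂   = A.⊤

  meetε : Polarity → A.Carrier → A.Carrier → A.Carrier
  meetε one = A._∧_
  meetε ∂   = A._∨_

  topε : Polarity → A.Carrier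
  topε one = A.⊤
  topε ∂   = A.⊥

_[_≔_] : ∀ {X : Set} {n} → Vector X n → Fin n → X → Vector X n
a [ i ≔ x ] = updateAt a i (const x)

module _ {A : BoundedLattice 0ℓ 0ℓ 0ℓ} (Aδ : CanonicalExtension A) where
  private module A = BoundedLattice A
  open CanonicalExtension Aδ
  open CompleteLattice C

  leqε : Polarity → Carrier → Carrier → Set
  leqε one x y = x ≤ y
  leqε ∂   x y = y ≤ x

  inKε : Polarity → Carrier → Set₁
  inKε one = IsClosed A C e
  inKε ∂   = IsOpen A C e

  inOε : Polarity → Carrier → Set₁
  inOε one = IsOpen A C e
  inOε ∂   = IsClosed A C e

  InK : ∀ {n} → (Fin n → Polarity) → Vector Carrier n → Set₁
  InK ε k = ∀ i → inKε (ε i) (k i)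

  InO : ∀ {n} → (Fin n → Polarity) → Vector Carrier n → Set₁
  InO ε o = ∀ i → inOε (ε i) (o i)

record SlantedAlgebra (L : LESignature) (A : BoundedLattice 0ℓ 0ℓ 0ℓ)
                      (Aδ : CanonicalExtension A) : Set₁ where
  open LESignature L
  private module A = BoundedLattice A
  open CanonicalExtension Aδ
  open CompleteLattice C
  field
    fop : (f : 𝓕) → Vector A.Carrier (arF f) → Carrier
    gop : (g : 𝓖) → Vector A.Carrier (arG g) → Carrier
    fop-cong : ∀ f {a b : Vector A.Carrier (arF f)} →
               (∀ i → a i A.≈ b i) → fop f a ≈ fop f b
    gop-cong : ∀ g {a b : Vector A.Carrier (arG g)} →
               (∀ i → a i A.≈ b i) → gop g a ≈ gop g b
    fop-join : ∀ f (a : Vector A.Carrier (arF f)) i x y →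
               fop f (a [ i ≔ joinε A (εF f i) x y ])
                 ≈ fop f (a [ i ≔ x ]) ⊔ fop f (a [ i ≔ y ])
    fop-bot  : ∀ f (a : Vector A.Carrier (arF f)) i →
               fop f (a [ i ≔ botε A (εF f i) ]) ≈ bot
    gop-meet : ∀ g (a : Vector A.Carrier (arG g)) i x y →
               gop g (a [ i ≔ meetε A (εG g i) x y ])
                 ≈ gop g (a [ i ≔ x ]) ⊓ gop g (a [ i ≔ y ])
    gop-top  : ∀ g (a : Vector A.Carrier (arG g)) i →
               gop g (a [ i ≔ topε A (εG g i) ]) ≈ top
    fop-closed : ∀ f a → IsClosed A C e (fop f a)
    gop-open   : ∀ g a → IsOpen A C e (gop g a)

  fσ : (f : 𝓕) → Vector Carrier (arF f) → Carrier
  fσ f k = ⋀ {Σ[ a ∈ Vector A.Carrier (arF f) ] (∀ i → leqε Aδ (εF f i) (k i) (e (a i)))}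
             (λ p → fop f (proj₁ p))

  gπ : (g : 𝓖) → Vector Carrier (arG g) → Carrier
  gπ g o = ⋁ {Σ[ a ∈ Vector A.Carrier (arG g) ] (∀ i → leqε Aδ (εG g i) (e (a i)) (o i))}
             (λ p → gop g (proj₁ p))

-- g^π(o) is a join of values of g and f^σ(k) a meet of values of f. Since g takes
-- open and f closed values, it suffices that open elements are closed under
-- arbitrary joins and closed elements under arbitrary meets: a join of joins of
-- subsets of A is the join of their union.
module Submission where

open import Defs
open import Level using (0ℓ)
open import Data.Product using (_×_; _,_; Σ-syntax; proj₁; proj₂)
open import Function using (_∘_)
open import Data.Vec.Functional using (Vector)
open import Relation.Binary using (IsPartialOrder)
open import Relation.Binary.Lattice.Bundles using (BoundedLattice)

module _ (A : BoundedLattice 0ℓ 0ℓ 0ℓ) (C : CompleteLattice)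
         (e : BoundedLattice.Carrier A → CompleteLattice.Carrier C) where
  private
    module A = BoundedLattice A
    open CompleteLattice C
    open IsPartialOrder isPartialOrder

  ⋁-preserves-IsOpen : {I : Set} (x : I → Carrier) →
                       (∀ i → IsOpen A C e (x i)) → IsOpen A C e (⋁ x)
  ⋁-preserves-IsOpen {I} x open-x = S , antisym ⋁x≤⋁S ⋁S≤⋁x
    where
    S : A.Carrier → Set
    S a = Σ[ i ∈ I ] proj₁ (open-x i) a

    ⋁x≤⋁S : ⋁ x ≤ ⋁ {Σ[ a ∈ A.Carrier ] S a} (e ∘ proj₁)
    ⋁x≤⋁S = ⋁-least x _ λ i → trans (reflexive (proj₂ (open-x i)))
      (⋁-least _ _ λ (a , s) → ⋁-upper (e ∘ proj₁) (a , i , s))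

    ⋁S≤⋁x : ⋁ {Σ[ a ∈ A.Carrier ] S a} (e ∘ proj₁) ≤ ⋁ x
    ⋁S≤⋁x = ⋁-least _ _ λ (a , i , s) →
      trans (⋁-upper (e ∘ proj₁) (a , s))
            (trans (reflexive (Eq.sym (proj₂ (open-x i)))) (⋁-upper x i))

  ⋀-preserves-IsClosed : {I : Set} (x : I → Carrier) →
                         (∀ i → IsClosed A C e (x i)) → IsClosed A C e (⋀ x)
  ⋀-preserves-IsClosed {I} x closed-x = S , antisym ⋀x≤⋀S ⋀S≤⋀x
    where
    S : A.Carrier → Set
    S a = Σ[ i ∈ I ] proj₁ (closed-x i) a

    ⋀x≤⋀S : ⋀ x ≤ ⋀ {Σ[ a ∈ A.Carrier ] S a} (e ∘ proj₁)
    ⋀x≤⋀S = ⋀-greatest _ _ λ (a , i , s) →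
      trans (trans (⋀-lower x i) (reflexive (proj₂ (closed-x i))))
            (⋀-lower (e ∘ proj₁) (a , s))

    ⋀S≤⋀x : ⋀ {Σ[ a ∈ A.Carrier ] S a} (e ∘ proj₁) ≤ ⋀ x
    ⋀S≤⋀x = ⋀-greatest x _ λ i →
      trans (⋀-greatest _ _ λ (a , s) → ⋀-lower (e ∘ proj₁) (a , i , s))
            (reflexive (Eq.sym (proj₂ (closed-x i))))

lemma8p1 : (L : LESignature) (A : BoundedLattice 0ℓ 0ℓ 0ℓ) (Aδ : CanonicalExtension A)
           (𝔸 : SlantedAlgebra L A Aδ) →
           ((g : LESignature.𝓖 L) (o : Vector (CompleteLattice.Carrier (CanonicalExtension.C Aδ)) (LESignature.arG L g)) →
             InO Aδ (LESignature.εG L g) o →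
             IsOpen A (CanonicalExtension.C Aδ) (CanonicalExtension.e Aδ)
               (SlantedAlgebra.gπ 𝔸 g o))
           ×
           ((f : LESignature.𝓕 L) (k : Vector (CompleteLattice.Carrier (CanonicalExtension.C Aδ)) (LESignature.arF L f)) →
             InK Aδ (LESignature.εF L f) k →
             IsClosed A (CanonicalExtension.C Aδ) (CanonicalExtension.e Aδ)
               (SlantedAlgebra.fσ 𝔸 f k))
lemma8p1 L A Aδ 𝔸 =
  (λ g o _ → ⋁-preserves-IsOpen A C e _ (gop-open g ∘ proj₁)) ,
  (λ f k _ → ⋀-preserves-IsClosed A C e _ (fop-closed f ∘ proj₁))
  where
  open CanonicalExtension Aδ
  open SlantedAlgebra 𝔸
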